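{- Assume the setting and Assumption $(\Omega)$ described in the context. Let $Q_{x,y} \in \mathcal{Q}$ be an overload-discharge quadruple associated with some $x, y \in V(C_T)$. Then $c(T[\rho(y)\rho(y^-); \rho(y^-)]) + c(\rho(y)) > k$.
   Context: $\mathbb{N} = \{1,2,\dots\}$. $T$ is a finite tree with vertex weights $c : V(T) \to \mathbb{N}$; for a subgraph $H$, $c(H) := \sum_{v \in V(H)} c(v)$. $k, g \in \mathbb{N}$ with $1 \leq k \leq N_2 := c(T)$ and $c(v) \leq k$ for all $v \in V(T)$. For an edge $vw$ of $T$, $T[vw; w]$ is the component of $T - vw$ containing $w$. Euler tour: fix a planar embedding of $T$. For each $v$, list the incident edges in clockwise order as $e_{v,1},\dots,e_{v,d_T(v)}$. The directed cycle $C_T$ has vertices $w_{v,i}$ ($v \in V(T)$, $1 \le i \le d_T(v)$), indices modulo $d_T(v)$, and for every edge $uv = e_{u,i} = e_{v,j}$ of $T$ it has arcs $w_{u,i} \to w_{v,j+1}$ and $w_{v,j} \to w_{u,i+1}$. For $x$ on $C_T$, $x^+$, $x^-$ are its successor and predecessor; $[x,y]$ is the directed path from $x$ to $y$ along $C_T$. Let $\rho(w_{v,i}) := v$ (consecutive vertices of $C_T$ map to adjacent vertices of $T$), $\rho([x,y])$ the subtree of $T$ induced by $\{\rho(z): z \in V([x,y])\}$, $c(z) := c(\rho(z))$, $c([x,y]) := c(\rho([x,y]))$. Assumption $(\Omega)$: there are no $x, y \in V(C_T)$ with $k - g + 1 \leq c([x,y]) \leq k$. If $u, v \in V(C_T)$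 satisfy $c([u, v^-]) < k - g + 1$ and $c([u,v]) > k$, let $w$ be the vertex of $[u, v^-]$ with $c([w,v]) > k$ and $c([w^+, v]) < k - g + 1$; the overload-discharge quadruple associated with $u,v$ is $Q_{u,v} := (\rho([u,v]), \rho(v), V(\rho([u,v])) \setminus V(\rho([w,v])), \rho(w))$. It is maximal if also $c([u^-, v^-]) > k$. $\mathcal{Q}$ is the set of all maximal quadruples. -}

module Defs where

open import Data.Nat using (ℕ; zero; suc; _+_; _≤_; _<_; _<?_)
open import Data.Fin using (Fin; toℕ; fromℕ<)
open import Data.Fin.Properties using (_≟_)
open import Data.Product using (Σ; ∃; ∃-syntax; _×_; _,_; proj₁; proj₂)
open import Data.Sum using (_⊎_)
open import Data.Bool using (Bool; true; false; if_then_else_)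
open import Data.List using (List; []; _∷_; _++_; map; length; allFin)
open import Data.Nat.ListAction using (sum)
open import Data.List.Relation.Unary.Any using (any?)
open import Data.List.Relation.Unary.Linked using (Linked)
open import Data.List.Relation.Unary.Unique.Propositional using (Unique)
open import Relation.Nullary using (¬_; does; yes; no)
open import Relation.Binary.PropositionalEquality using (_≡_; _≢_)
open import Function.Definitions using (Injective)

-- Graph notions on vertex set Fin n, given by neighbour lists.
-- deg v = d_T(v); nbr v i = the other endpoint of e_{v,i}
-- (edges at v listed in clockwise order e_{v,0},...,e_{v,deg v - 1}).

module _ {n : ℕ} (deg : Fin n → ℕ) (nbr : (v : Fin n) → Fin (deg v) → Fin n) where

  Adj : Fin n → Fin n → Set
  Adj u v = ∃[ i ] nbr u i ≡ v

  IsConnected : Set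
  IsConnected = ∀ u v → u ≡ v ⊎ ∃[ vs ] Linked Adj (u ∷ vs ++ v ∷ [])

  IsCycle : Fin n → List (Fin n) → Set
  IsCycle v vs = 2 ≤ length vs × Unique (v ∷ vs) × Linked Adj (v ∷ vs ++ v ∷ [])

  IsAcyclic : Set
  IsAcyclic = ∀ v vs → ¬ IsCycle v vs

-- A finite tree together with a planar embedding (clockwise rotation at each vertex).
record PlaneTree (n : ℕ) : Set where
  field
    deg       : Fin n → ℕ
    nbr       : (v : Fin n) → Fin (deg v) → Fin n
    nbr-inj   : ∀ v → Injective _≡_ _≡_ (nbr v)
    loopless  : ∀ v i → nbr v i ≢ v
    symmetric : ∀ v i → ∃[ j ] nbr (nbr v i) j ≡ v
    connected : IsConnected deg nbr
    acyclic   : IsAcyclic deg nbr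

wS : ∀ {n} → (Fin n → ℕ) → (Fin n → Bool) → ℕ
wS {n} c S = sum (map (λ u → if S u then c u else 0) (allFin n))

wL : ∀ {n} → (Fin n → ℕ) → List (Fin n) → ℕ
wL c l = wS c (λ u → does (any? (u ≟_) l))

cnext : ∀ {d} → Fin d → Fin d
cnext {suc d} i with suc (toℕ i) <? suc d
... | yes p = fromℕ< p
... | no _  = Fin.zero

module Tour {n : ℕ} (T : PlaneTree n) where
  open PlaneTree T

  -- vertices w_{v,i} of C_T
  CV : Set
  CV = Σ (Fin n) (λ v → Fin (deg v))

  ρ : CV → Fin n
  ρ = proj₁

  Arc : CV → CV → Set
  Arc (u , i) (v , j') = nbr u i ≡ v × ∃[ j ] (nbr v j ≡ u × j' ≡ cnext j)

  -- Seg x y ps : ps is the vertex sequence of the directed path [x,y] along C_T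
  -- (starting at x, following arcs, stopping at the first visit of y)
  data Seg : CV → CV → List CV → Set where
    here : ∀ {x} → Seg x x (x ∷ [])
    step : ∀ {x x' y ps} → x ≢ y → Arc x x' → Seg x' y ps → Seg x y (x ∷ ps)

  SegCost : (Fin n → ℕ) → CV → CV → ℕ → Set
  SegCost c x y s = ∃[ ps ] (Seg x y ps × wL c (map ρ ps) ≡ s)

  Omega : (Fin n → ℕ) → ℕ → ℕ → Set
  Omega c k g = ∀ x y s → SegCost c x y s → ¬ (k < s + g × s ≤ k)

  AdjMinus : Fin n → Fin n → Fin n → Fin n → Set
  AdjMinus v w a b = Adj deg nbr a b × ¬ (a ≡ v × b ≡ w) × ¬ (a ≡ w × b ≡ v)

  -- u lies in T[vw; w], the component of T - vw containing w
  InComp : Fin n → Fin n → Fin n → Set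
  InComp v w u = u ≡ w ⊎ ∃[ vs ] Linked (AdjMinus v w) (w ∷ vs ++ u ∷ [])

  IsComp : Fin n → Fin n → (Fin n → Bool) → Set
  IsComp v w S = ∀ u → (S u ≡ true → InComp v w u) × (InComp v w u → S u ≡ true)

{-# OPTIONS --safe #-}
-- Since c([x,y⁻]) ≤ k - g < c([x,y]) and [x,y] is [x,y⁻] followed by y, the tree vertex ρ(y)
-- is not visited by [x,y⁻]. Consecutive tour vertices are joined by tree edges, so the walk
-- ρ([x,y⁻]) stays inside T[ρ(y)ρ(y⁻); ρ(y⁻)], and prepending x⁻ adds at most the vertex ρ(y).
-- Hence k < c([x⁻,y⁻]) ≤ c(T[ρ(y)ρ(y⁻); ρ(y⁻)]) + c(ρ(y)).
module Submission where

open import Algebra.Properties.CommutativeSemigroup using (xy∙z≈xz∙y)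
open import Data.Bool using (Bool; true; false; if_then_else_)
open import Data.Fin using (Fin)
open import Data.Fin.Properties using (_≟_)
open import Data.List using (List; []; _∷_; _++_; map; allFin)
open import Data.List.Membership.Propositional using (_∈_; _∉_)
open import Data.List.Membership.Propositional.Properties using (∈-map⁺; ∈-map⁻)
open import Data.List.Relation.Binary.Subset.Propositional using (_⊆_)
open import Data.List.Relation.Binary.Subset.Propositional.Properties
  using (⊆-refl; ⊆-trans; map⁺; xs⊆x∷xs; ∷⁺ʳ; ∈-∷⁺ʳ)
open import Data.List.Relation.Unary.All as All using (All; []; _∷_)
open import Data.List.Relation.Unary.Any using (here; there; any?)
open import Data.List.Relation.Unary.Linked using (Linked; [-]; _∷_)
open import Data.List.Relation.Unary.Unique.Propositional using (Unique; []; _∷_)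
open import Data.List.Relation.Unary.Unique.Propositional.Properties using (allFin⁺)
open import Data.Nat using (ℕ; _+_; _≤_; _<_; z≤n)
open import Data.Nat.ListAction using (sum)
open import Data.Nat.Properties
  using (≤-refl; ≤-trans; ≤-reflexive; +-mono-≤; +-assoc; m≤m+n; m≤n+m; <-≤-trans; ≤-<-trans; <⇒≱; +-commutativeSemigroup)
open import Data.Product using (∃-syntax; _×_; _,_; proj₂)
open import Data.Sum using (_⊎_; inj₁; inj₂; map₁; fromInj₁)
open import Relation.Binary.Definitions using (DecidableEquality)
open import Relation.Binary.PropositionalEquality using (_≡_; refl; sym; trans; cong; _≢_)
open import Relation.Nullary using (does; yes; no; contradiction)
open import Relation.Nullary.Decidable using (dec-true)
open import Function using (_∘_)
open import Defs

sum-map-mono : ∀ {A : Set} {f g : A → ℕ} {xs : List A}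
  → All (λ x → f x ≤ g x) xs → sum (map f xs) ≤ sum (map g xs)
sum-map-mono []       = z≤n
sum-map-mono (p ∷ ps) = +-mono-≤ p (sum-map-mono ps)

sum-map-≤-+ : ∀ {A : Set} → DecidableEquality A → ∀ {f g : A → ℕ} {a : A} {m : ℕ} {xs : List A}
  → Unique xs → (∀ {x} → x ≢ a → f x ≤ g x) → f a ≤ g a + m
  → sum (map f xs) ≤ sum (map g xs) + m
sum-map-≤-+ _≟_ [] _ _ = z≤n
sum-map-≤-+ _≟_ {f} {g} {a} {m} {x ∷ xs} (x∉xs ∷ xs-unique) f≤g fa≤ga+m with x ≟ a
... | yes refl = ≤-trans
  (+-mono-≤ fa≤ga+m (sum-map-mono (All.map (λ a≢y → f≤g (a≢y ∘ sym)) x∉xs)))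
  (≤-reflexive (xy∙z≈xz∙y +-commutativeSemigroup (g x) m (sum (map g xs))))
... | no x≢a = ≤-trans
  (+-mono-≤ (f≤g x≢a) (sum-map-≤-+ _≟_ xs-unique f≤g fa≤ga+m))
  (≤-reflexive (sym (+-assoc (g x) (sum (map g xs)) m)))

if-mono : ∀ {b b' : Bool} (m : ℕ) → (b ≡ true → b' ≡ true)
  → (if b then m else 0) ≤ (if b' then m else 0)
if-mono {false}          _ _ = z≤n
if-mono {true}  {true}   _ _ = ≤-refl
if-mono {true}  {false}  _ b⇒b' with () ← b⇒b' refl

if-≤-+ : ∀ (b : Bool) (m n : ℕ) → (if b then m else 0) ≤ n + m
if-≤-+ false m n = z≤n
if-≤-+ true  m n = m≤n+m m n

module _ {n : ℕ} (c : Fin n → ℕ) where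

  wS-mono : ∀ {S S' : Fin n → Bool} → (∀ u → S u ≡ true → S' u ≡ true) → wS c S ≤ wS c S'
  wS-mono S⊆S' = sum-map-mono {xs = allFin n} (All.tabulate (λ {u} _ → if-mono (c u) (S⊆S' u)))

  wS-≤-+ : ∀ {S S' : Fin n → Bool} {a : Fin n}
    → (∀ u → S u ≡ true → S' u ≡ true ⊎ u ≡ a) → wS c S ≤ wS c S' + c a
  wS-≤-+ {S} {S'} {a} S⊆S'∪a = sum-map-≤-+ _≟_ {xs = allFin n} (allFin⁺ n) outside-a (if-≤-+ (S a) (c a) _)
    where
    outside-a : ∀ {u} → u ≢ a → (if S u then c u else 0) ≤ (if S' u then c u else 0)
    outside-a {u} u≢a =
      if-mono (c u) λ Su → fromInj₁ (λ u≡a → contradiction u≡a u≢a) (S⊆S'∪a u Su)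

  ∈-of-does-any? : ∀ {u : Fin n} (us : List (Fin n)) → does (any? (u ≟_) us) ≡ true → u ∈ us
  ∈-of-does-any? {u} us _ with any? (u ≟_) us
  ... | yes u∈us = u∈us

  wL-mono : ∀ {us vs : List (Fin n)} → us ⊆ vs → wL c us ≤ wL c vs
  wL-mono {us} {vs} us⊆vs =
    wS-mono λ u u∈us → dec-true (any? (u ≟_) vs) (us⊆vs (∈-of-does-any? us u∈us))

  wL-≤-wS-+ : ∀ {us : List (Fin n)} {S : Fin n → Bool} {a : Fin n}
    → (∀ {u} → u ∈ us → S u ≡ true ⊎ u ≡ a) → wL c us ≤ wS c S + c a
  wL-≤-wS-+ {us} us⊆S∪a = wS-≤-+ λ u u∈us → us⊆S∪a (∈-of-does-any? us u∈us)

module TourProperties {n : ℕ} (T : PlaneTree n) where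
  open PlaneTree T
  open Tour T

  Arc-functional : ∀ {a b b'} → Arc a b → Arc a b' → b ≡ b'
  Arc-functional {a , i} (refl , j , e , refl) (refl , j' , e' , refl)
    with nbr-inj (nbr a i) (trans e (sym e'))
  ... | refl = refl

  Seg-functional : ∀ {a z ps qs} → Seg a z ps → Seg a z qs → ps ≡ qs
  Seg-functional here               here               = refl
  Seg-functional here               (step a≢a _ _)     = contradiction refl a≢a
  Seg-functional (step a≢a _ _)     here               = contradiction refl a≢a
  Seg-functional (step _ a→b [b,z]) (step _ a→b' [b',z]) with Arc-functional a→b a→b'
  ... | refl = cong (_ ∷_) (Seg-functional [b,z] [b',z])

  Seg-source∈ : ∀ {a z ps} → Seg a z ps → a ∈ ps
  Seg-source∈ here         = here refl
  Seg-source∈ (step _ _ _) = here refl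

  Seg-cons-⊆ : ∀ {a x z ps qs} → Arc a x → Seg a z ps → Seg x z qs → ps ⊆ a ∷ qs
  Seg-cons-⊆ _   here                 _     = ∈-∷⁺ʳ (here refl) λ ()
  Seg-cons-⊆ a→x (step _ a→x' [x',z]) [x,z] with Arc-functional a→x' a→x
  ... | refl with Seg-functional [x',z] [x,z]
  ... | refl = ⊆-refl

  Seg-snoc-⊆ : ∀ {x z y ps qs} → Seg x z ps → Arc z y → Seg x y qs → qs ⊆ y ∷ ps
  Seg-snoc-⊆ _     _   here = ∈-∷⁺ʳ (here refl) λ ()
  Seg-snoc-⊆ {x} {z} {y} [x,z] z→y (step {ps = qs} _ x→x' [x',y]) =
    ∈-∷⁺ʳ (there (Seg-source∈ [x,z])) (tail-⊆ [x,z])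
    where
    tail-⊆ : ∀ {ps} → Seg x z ps → qs ⊆ y ∷ ps
    tail-⊆ here with Arc-functional x→x' z→y
    ... | refl with Seg-functional [x',y] here
    ... | refl = ∈-∷⁺ʳ (here refl) λ ()
    tail-⊆ (step _ x→x'' [x'',z]) with Arc-functional x→x' x→x''
    ... | refl = ⊆-trans (Seg-snoc-⊆ [x'',z] z→y [x',y]) (∷⁺ʳ y (xs⊆x∷xs _ _))

  Arc⇒Adj : ∀ {a b} → Arc a b → Adj deg nbr (ρ b) (ρ a)
  Arc⇒Adj {a , i} (refl , _) = symmetric a i

  Adj⇒AdjMinus : ∀ {v w a b} → Adj deg nbr a b → a ≢ v → b ≢ v → AdjMinus v w a b
  Adj⇒AdjMinus a~b a≢v b≢v = a~b , (λ (a≡v , _) → a≢v a≡v) , (λ (_ , b≡v) → b≢v b≡v)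

  InComp-step : ∀ {v w a b} → InComp v w a → AdjMinus v w a b → InComp v w b
  InComp-step (inj₁ refl)        a~b = inj₂ ([] , a~b ∷ [-])
  InComp-step (inj₂ (vs , path)) a~b = inj₂ (vs ++ _ ∷ [] , snoc vs path a~b)
    where
    snoc : ∀ {R : Fin n → Fin n → Set} {w a b} (vs : List (Fin n))
      → Linked R (w ∷ vs ++ a ∷ []) → R a b → Linked R (w ∷ (vs ++ a ∷ []) ++ b ∷ [])
    snoc []       (r ∷ [-])  r' = r ∷ r' ∷ [-]
    snoc (_ ∷ vs) (r ∷ rs)   r' = r ∷ snoc vs rs r'

  ∉-map-ρ : ∀ {r p ps} → r ∉ map ρ ps → p ∈ ps → ρ p ≢ r
  ∉-map-ρ r∉ p∈ refl = r∉ (∈-map⁺ ρ p∈)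

  -- A stretch of the tour that avoids r never crosses an edge at r.
  Seg-avoiding⇒InComp : ∀ {a z ps} (r : Fin n) → Seg a z ps → r ∉ map ρ ps
    → ∀ {p} → p ∈ ps → InComp r (ρ z) (ρ p)
  Seg-avoiding⇒InComp r here               _  (here refl) = inj₁ refl
  Seg-avoiding⇒InComp r (step _ _ [b,z])    r∉ (there p∈)  = Seg-avoiding⇒InComp r [b,z] (r∉ ∘ there) p∈
  Seg-avoiding⇒InComp r (step _ a→b [b,z])  r∉ (here refl) =
    InComp-step (Seg-avoiding⇒InComp r [b,z] (r∉ ∘ there) b∈)
      (Adj⇒AdjMinus (Arc⇒Adj a→b) (∉-map-ρ (r∉ ∘ there) b∈) (λ ρa≡r → r∉ (here (sym ρa≡r))))
    where b∈ = Seg-source∈ [b,z]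

  Seg-pred-⊆-InComp : ∀ {x⁻ x z ps⁻ ps} (r : Fin n) → Arc x⁻ x → Seg x⁻ z ps⁻ → Seg x z ps
    → r ∉ map ρ ps → ∀ {p} → p ∈ ps⁻ → InComp r (ρ z) (ρ p) ⊎ ρ p ≡ r
  Seg-pred-⊆-InComp {x⁻} r x⁻→x [x⁻,z] [x,z] r∉ p∈ with Seg-cons-⊆ x⁻→x [x⁻,z] [x,z] p∈
  ... | there p∈ps = inj₁ (Seg-avoiding⇒InComp r [x,z] r∉ p∈ps)
  ... | here refl with ρ x⁻ ≟ r
  ...   | yes ρx⁻≡r = inj₂ ρx⁻≡r
  ...   | no  ρx⁻≢r = inj₁ (InComp-step (Seg-avoiding⇒InComp r [x,z] r∉ x∈)
                         (Adj⇒AdjMinus (Arc⇒Adj x⁻→x) (∉-map-ρ r∉ x∈) ρx⁻≢r))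
    where x∈ = Seg-source∈ [x,z]

  -- Otherwise [x,y] would add no new vertex to [x,y⁻].
  Seg-cost-grows⇒∉ : ∀ (c : Fin n → ℕ) {x y⁻ y ps qs} → Seg x y⁻ ps → Arc y⁻ y → Seg x y qs
    → wL c (map ρ ps) < wL c (map ρ qs) → ρ y ∉ map ρ ps
  Seg-cost-grows⇒∉ c [x,y⁻] y⁻→y [x,y] cost< ρy∈ =
    <⇒≱ cost< (wL-mono c (⊆-trans (map⁺ ρ (Seg-snoc-⊆ [x,y⁻] y⁻→y [x,y])) (∈-∷⁺ʳ ρy∈ ⊆-refl)))

lemma4 : ∀ {n} (T : PlaneTree n) (c : Fin n → ℕ) (k g : ℕ)
    → (∀ v → 1 ≤ c v) → 1 ≤ g
    → 1 ≤ k → k ≤ wS c (λ _ → true) → (∀ v → c v ≤ k)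
    → Tour.Omega T c k g
    → ∀ x y x⁻ y⁻ → Tour.Arc T x⁻ x → Tour.Arc T y⁻ y
    → (∃[ s ] (Tour.SegCost T c x y⁻ s × s + g ≤ k))
    → (∃[ s ] (Tour.SegCost T c x y s × k < s))
    → (∃[ s ] (Tour.SegCost T c x⁻ y⁻ s × k < s))
    → ∀ (S : Fin n → Bool) → Tour.IsComp T (Tour.ρ T y) (Tour.ρ T y⁻) S
    → k < wS c S + c (Tour.ρ T y)
lemma4 T c k g _ _ _ _ _ _ x y x⁻ y⁻ x⁻→x y⁻→y
  (_ , (ps , [x,y⁻] , refl) , cost[x,y⁻]+g≤k)
  (_ , (qs , [x,y] , refl) , k<cost[x,y])
  (_ , (ps⁻ , [x⁻,y⁻] , refl) , k<cost[x⁻,y⁻]) S S-comp =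
  <-≤-trans k<cost[x⁻,y⁻] (wL-≤-wS-+ c ρ[x⁻,y⁻]⊆S∪ρy)
  where
  open Tour T
  open TourProperties T

  ρy∉ρ[x,y⁻] : ρ y ∉ map ρ ps
  ρy∉ρ[x,y⁻] = Seg-cost-grows⇒∉ c [x,y⁻] y⁻→y [x,y]
    (≤-<-trans (≤-trans (m≤m+n _ g) cost[x,y⁻]+g≤k) k<cost[x,y])

  ρ[x⁻,y⁻]⊆S∪ρy : ∀ {u} → u ∈ map ρ ps⁻ → S u ≡ true ⊎ u ≡ ρ y
  ρ[x⁻,y⁻]⊆S∪ρy u∈ with ∈-map⁻ ρ u∈
  ... | p , p∈ , refl =
    map₁ (proj₂ (S-comp (ρ p))) (Seg-pred-⊆-InComp (ρ y) x⁻→x [x⁻,y⁻] [x,y⁻] ρy∉ρ[x,y⁻] p∈)
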